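{- Let $q$ be a prime power and let $k, s$ be fixed positive integers. Let $\mathcal{V}_1, \dots, \mathcal{V}_{s+1}$ be families of $k$-dimensional subspaces of $\mathbb{F}_q^n$ such that there are no pairwise disjoint $V_1, \dots, V_{s+1}$ with $V_i \in \mathcal{V}_i$ for every $i = 1, \dots, s+1$. Then for $n$ sufficiently large, \[\min_{i \in [s+1]} |\mathcal{V}_i| \leq \genfrac{[}{]}{0pt}{}{n}{k} - \genfrac{[}{]}{0pt}{}{n-1}{k}.\]
   Context: $\genfrac{[}{]}{0pt}{}{n}{k} = \prod_{0 \leq i \leq k-1}\frac{q^{n-i}-1}{q^{k-i}-1}$. Two subspaces are disjoint if their intersection is the zero subspace. $[s+1] = \{1, \dots, s+1\}$. -}

module Defs where

open import Level using (0ℓ)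
open import Data.Nat using (ℕ; zero; suc; _∸_; _^_; _⊓_; _/_)
import Data.Nat as ℕ
open import Data.Fin using (Fin)
import Data.Fin as F
open import Data.List using (List; length; lookup)
open import Data.List.Relation.Unary.AllPairs using (AllPairs)
open import Data.Product using (Σ; ∃; _×_; _,_)
open import Relation.Binary.PropositionalEquality using (_≡_)
open import Relation.Nullary using (¬_)
open import Algebra.Structures using (IsCommutativeRing)
open import Function.Bundles using (_↔_)

record FiniteField (q : ℕ) : Set₁ where
  field
    Carrier : Set
    _+_ _*_ : Carrier → Carrier → Carrier
    -_ : Carrier → Carrier
    0# 1# : Carrier
    isCommutativeRing : IsCommutativeRing _≡_ _+_ _*_ -_ 0# 1#
    0≢1 : ¬ (0# ≡ 1#)
    inverse : ∀ x → ¬ (x ≡ 0#) → Σ Carrier (λ y → (x * y) ≡ 1#)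
    enumeration : Carrier ↔ Fin q

module VectorSpace {q : ℕ} (𝔽 : FiniteField q) (n : ℕ) where
  open FiniteField 𝔽

  Vector : Set
  Vector = Fin n → Carrier

  zeroV : Vector
  zeroV _ = 0#

  _+V_ : Vector → Vector → Vector
  (u +V v) i = u i + v i

  _·_ : Carrier → Vector → Vector
  (a · v) i = a * v i

  _≈V_ : Vector → Vector → Set
  u ≈V v = ∀ i → u i ≡ v i

  lincomb : ∀ {k} → (Fin k → Carrier) → (Fin k → Vector) → Vector
  lincomb {zero}  c B = zeroV
  lincomb {suc k} c B = (c F.zero · B F.zero) +V lincomb (λ j → c (F.suc j)) (λ j → B (F.suc j))

  LinearlyIndependent : ∀ {k} → (Fin k → Vector) → Set
  LinearlyIndependent {k} B = ∀ (c : Fin k → Carrier) → lincomb c B ≈V zeroV → ∀ j → c j ≡ 0#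

  -- a k-dimensional subspace, presented by a basis (its span)
  record Subspace (k : ℕ) : Set where
    constructor ⟨_,_⟩
    field
      basis : Fin k → Vector
      independent : LinearlyIndependent basis
  open Subspace public

  _∈_ : ∀ {k} → Vector → Subspace k → Set
  v ∈ U = ∃ λ c → v ≈V lincomb c (basis U)

  _≐_ : ∀ {k} → Subspace k → Subspace k → Set
  U ≐ W = (∀ v → v ∈ U → v ∈ W) × (∀ v → v ∈ W → v ∈ U)

  Disjoint : ∀ {k} → Subspace k → Subspace k → Set
  Disjoint U W = ∀ v → v ∈ U → v ∈ W → v ≈V zeroV

  record Family (k : ℕ) : Set where
    field
      members : List (Subspace k)
      distinct : AllPairs (λ U W → ¬ (U ≐ W)) members
  open Family public

  card : ∀ {k} → Family k → ℕ
  card 𝒱 = length (members 𝒱)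

-- Gaussian binomial coefficient via the product formula
--   [n k]_q = ∏_{0≤i≤k-1} (q^{n-i} - 1) / (q^{k-i} - 1)
-- computed as (∏ numerators) / (∏ denominators), an exact division.

prodUpTo : ℕ → (ℕ → ℕ) → ℕ
prodUpTo zero    f = 1
prodUpTo (suc m) f = prodUpTo m f ℕ.* f m

-- division, with the (never used for q ≥ 2) convention m / 0 = 0
divN : ℕ → ℕ → ℕ
divN m zero    = 0
divN m (suc d) = m / suc d

gauss : ℕ → ℕ → ℕ → ℕ
gauss q n k = divN (prodUpTo k (λ i → q ^ (n ∸ i) ∸ 1))
                   (prodUpTo k (λ i → q ^ (k ∸ i) ∸ 1))

minFin : ∀ {m} → (Fin (suc m) → ℕ) → ℕ
minFin {zero}  f = f F.zero
minFin {suc m} f = f F.zero ⊓ minFin (λ i → f (F.suc i))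

{-# OPTIONS --safe #-}
-- A k-space U meeting a fixed k-space P is determined by a pivot j, the coordinates in P of a
-- nonzero w ∈ U ∩ P, and the basis vectors of U other than the j-th: exchanging the j-th basis
-- vector for w does not change the span.  So at most k q^k q^(n(k-1)) members of a family meet P,
-- and a family with more than s times that many members has a member disjoint from any s given
-- k-spaces.  If every family were larger than [n k] - [n-1 k], which grows like q^(k(n-k)), this
-- would hold for large n, and pairwise disjoint representatives could be chosen greedily.
module Submission where

open import Defs
open import Level using (0ℓ)
open import Data.Nat using (ℕ; zero; suc; _^_; _≤_; _<_; _∸_; _≤?_; s≤s⁻¹)
import Data.Nat as ℕ
open import Data.Nat.Properties
  using (≤-refl; ≤-trans; <-trans; ≤-<-trans; <-≤-trans; <⇒≱; ≰⇒>; n≤1+n; *-monoˡ-≤; m⊓n≤m; m⊓n≤n)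
open import Data.Fin using (Fin; zero; suc; punchIn; punchOut; _≟_; funToFin; finToFun; combine)
open import Data.Fin.Properties
  using (punchIn-punchOut; combine-injective; combine-injectiveˡ; combine-injectiveʳ; injective⇒≤;
         finToFun-funToFin; all?; any?; ¬∀⟶∃¬)
open import Data.Vec.Functional using (updateAt)
open import Data.Vec.Functional.Properties using (updateAt-updates; updateAt-minimal)
open import Data.List using (lookup)
import Data.List.Relation.Unary.All as All
open import Data.List.Membership.Propositional.Properties using (∈-lookup)
open import Data.Product using (Σ; ∃; _×_; _,_; proj₁; proj₂)
open import Function using (_∘_; const)
open import Function.Bundles using (Inverse; Injection)
open import Function.Definitions using (Injective)
open import Function.Properties.Inverse using (↔⇒↣)
open import Relation.Binary.Definitions using (Symmetric; DecidableEquality)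
open import Relation.Binary.PropositionalEquality
open import Relation.Nullary using (¬_; yes; no; contradiction)
open import Relation.Nullary.Decidable using (Dec; map′; ¬?; _×-dec_; decidable-stable)
open import Algebra.Bundles using (CommutativeRing)

module LinearAlgebra {q : ℕ} (𝔽 : FiniteField q) (n : ℕ) where
  open FiniteField 𝔽
  open VectorSpace 𝔽 n
  open import Data.Vec.Functional using (_∷_)

  ring : CommutativeRing 0ℓ 0ℓ
  ring = record { isCommutativeRing = isCommutativeRing }

  open CommutativeRing ring
    using (+-identityˡ; +-identityʳ; *-identityˡ; *-assoc; *-comm; zeroˡ; zeroʳ; distribˡ; distribʳ;
           +-commutativeSemigroup; +-group)
  open import Algebra.Properties.CommutativeSemigroup +-commutativeSemigroup using (interchange; x∙yz≈y∙xz)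
  open import Algebra.Properties.Ring (CommutativeRing.ring ring) using (-1*x≈-x)
  open import Algebra.Properties.Group +-group using (//-rightDividesʳ)

  ≈V-sym : ∀ {u v} → u ≈V v → v ≈V u
  ≈V-sym u≈v i = sym (u≈v i)

  ≈V-trans : ∀ {u v w} → u ≈V v → v ≈V w → u ≈V w
  ≈V-trans u≈v v≈w i = trans (u≈v i) (v≈w i)

  infix 4 _∈⟨_⟩
  _∈⟨_⟩ : ∀ {k} → Vector → (Fin k → Vector) → Set
  v ∈⟨ B ⟩ = ∃ λ c → v ≈V lincomb c B

  _⊆⟨⟩_ : ∀ {k m} → (Fin k → Vector) → (Fin m → Vector) → Set
  B ⊆⟨⟩ B′ = ∀ v → v ∈⟨ B ⟩ → v ∈⟨ B′ ⟩

  record SameSpan {k m} (B : Fin k → Vector) (B′ : Fin m → Vector) : Set where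
    constructor _⇄_
    field
      forth : B ⊆⟨⟩ B′
      back  : B′ ⊆⟨⟩ B

  lincomb-cong : ∀ {k} {c c′ : Fin k → Carrier} {B B′ : Fin k → Vector} →
                 (∀ i → (c i · B i) ≈V (c′ i · B′ i)) → lincomb c B ≈V lincomb c′ B′
  lincomb-cong {zero}  eq l = refl
  lincomb-cong {suc k} eq l = cong₂ _+_ (eq zero l) (lincomb-cong (eq ∘ suc) l)

  lincomb-congˡ : ∀ {k} {c c′ : Fin k → Carrier} {B : Fin k → Vector} →
                  (∀ i → c i ≡ c′ i) → lincomb c B ≈V lincomb c′ B
  lincomb-congˡ {B = B} c≡c′ = lincomb-cong (λ i l → cong (_* B i l) (c≡c′ i))

  lincomb-zeroˡ : ∀ {k} (B : Fin k → Vector) → lincomb (const 0#) B ≈V zeroV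
  lincomb-zeroˡ {zero}  B l = refl
  lincomb-zeroˡ {suc k} B l =
    trans (cong₂ _+_ (zeroˡ (B zero l)) (lincomb-zeroˡ (B ∘ suc) l)) (+-identityˡ 0#)

  lincomb-+ : ∀ {k} (c d : Fin k → Carrier) (B : Fin k → Vector) →
              lincomb (λ i → c i + d i) B ≈V (lincomb c B +V lincomb d B)
  lincomb-+ {zero}  c d B l = sym (+-identityˡ 0#)
  lincomb-+ {suc k} c d B l =
    trans (cong₂ _+_ (distribʳ (B zero l) (c zero) (d zero)) (lincomb-+ (c ∘ suc) (d ∘ suc) (B ∘ suc) l))
          (interchange _ _ _ _)

  lincomb-· : ∀ {k} (a : Carrier) (c : Fin k → Carrier) (B : Fin k → Vector) →
              lincomb (λ i → a * c i) B ≈V (a · lincomb c B)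
  lincomb-· {zero}  a c B l = sym (zeroʳ a)
  lincomb-· {suc k} a c B l =
    trans (cong₂ _+_ (*-assoc a (c zero) (B zero l)) (lincomb-· a (c ∘ suc) (B ∘ suc) l))
          (sym (distribˡ a _ _))

  lincomb-split : ∀ {k} (c : Fin k → Carrier) (B : Fin k → Vector) j →
                  lincomb c B ≈V ((c j · B j) +V lincomb (updateAt c j (const 0#)) B)
  lincomb-split c B zero l = cong ((c zero * B zero l) +_)
    (sym (trans (cong (_+ lincomb (c ∘ suc) (B ∘ suc) l) (zeroˡ (B zero l))) (+-identityˡ _)))
  lincomb-split c B (suc j) l =
    trans (cong ((c zero * B zero l) +_) (lincomb-split (c ∘ suc) (B ∘ suc) j l)) (x∙yz≈y∙xz _ _ _)

  ∈⟨⟩-resp : ∀ {k} {B : Fin k → Vector} {u v} → u ≈V v → u ∈⟨ B ⟩ → v ∈⟨ B ⟩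
  ∈⟨⟩-resp u≈v (c , u≈) = c , ≈V-trans (≈V-sym u≈v) u≈

  ∈⟨⟩-zero : ∀ {k} (B : Fin k → Vector) → zeroV ∈⟨ B ⟩
  ∈⟨⟩-zero B = const 0# , ≈V-sym (lincomb-zeroˡ B)

  ∈⟨⟩-+ : ∀ {k} {B : Fin k → Vector} {u v} → u ∈⟨ B ⟩ → v ∈⟨ B ⟩ → (u +V v) ∈⟨ B ⟩
  ∈⟨⟩-+ {B = B} (c , u≈) (d , v≈) =
    (λ i → c i + d i) , λ l → trans (cong₂ _+_ (u≈ l) (v≈ l)) (sym (lincomb-+ c d B l))

  ∈⟨⟩-· : ∀ {k} {B : Fin k → Vector} a {u} → u ∈⟨ B ⟩ → (a · u) ∈⟨ B ⟩
  ∈⟨⟩-· {B = B} a (c , u≈) = (λ i → a * c i) , λ l → trans (cong (a *_) (u≈ l)) (sym (lincomb-· a c B l))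

  basis-∈⟨⟩ : ∀ {k} (B : Fin k → Vector) j → B j ∈⟨ B ⟩
  basis-∈⟨⟩ B zero = 1# ∷ const 0# , λ l →
    sym (trans (cong₂ _+_ (*-identityˡ (B zero l)) (lincomb-zeroˡ (B ∘ suc) l)) (+-identityʳ _))
  basis-∈⟨⟩ B (suc j) with basis-∈⟨⟩ (B ∘ suc) j
  ... | c , Bj≈ = 0# ∷ c , λ l →
    trans (Bj≈ l) (sym (trans (cong (_+ lincomb c (B ∘ suc) l) (zeroˡ (B zero l))) (+-identityˡ _)))

  lincomb-∈⟨⟩ : ∀ {k m} {B : Fin k → Vector} {B′ : Fin m → Vector} →
                (∀ i → B′ i ∈⟨ B ⟩) → ∀ c → lincomb c B′ ∈⟨ B ⟩
  lincomb-∈⟨⟩ {m = zero}  {B} B′⊆B c = ∈⟨⟩-zero B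
  lincomb-∈⟨⟩ {m = suc m}     B′⊆B c = ∈⟨⟩-+ (∈⟨⟩-· (c zero) (B′⊆B zero)) (lincomb-∈⟨⟩ (B′⊆B ∘ suc) (c ∘ suc))

  generators-⊆⟨⟩ : ∀ {k m} {B : Fin k → Vector} {B′ : Fin m → Vector} → (∀ i → B′ i ∈⟨ B ⟩) → B′ ⊆⟨⟩ B
  generators-⊆⟨⟩ B′⊆B v (c , v≈) = ∈⟨⟩-resp (≈V-sym v≈) (lincomb-∈⟨⟩ B′⊆B c)

  ≈V-SameSpan : ∀ {k} {B B′ : Fin k → Vector} → (∀ i → B i ≈V B′ i) → SameSpan B B′
  ≈V-SameSpan {B = B} {B′} B≈B′ =
    generators-⊆⟨⟩ (λ i → ∈⟨⟩-resp (≈V-sym (B≈B′ i)) (basis-∈⟨⟩ B′ i)) ⇄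
    generators-⊆⟨⟩ (λ i → ∈⟨⟩-resp (B≈B′ i) (basis-∈⟨⟩ B i))

  SameSpan-trans : ∀ {k m o} {B : Fin k → Vector} {B′ : Fin m → Vector} {B″ : Fin o → Vector} →
                   SameSpan B B′ → SameSpan B′ B″ → SameSpan B B″
  SameSpan-trans (B⊆B′ ⇄ B′⊆B) (B′⊆B″ ⇄ B″⊆B′) =
    (λ v → B′⊆B″ v ∘ B⊆B′ v) ⇄ (λ v → B′⊆B v ∘ B″⊆B′ v)

  SameSpan-sym : ∀ {k m} {B : Fin k → Vector} {B′ : Fin m → Vector} → SameSpan B B′ → SameSpan B′ B
  SameSpan-sym (B⊆B′ ⇄ B′⊆B) = B′⊆B ⇄ B⊆B′

  exchange : ∀ {k} (B : Fin k → Vector) (c : Fin k → Carrier) {w : Vector} j →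
             c j ≢ 0# → w ≈V lincomb c B → SameSpan B (updateAt B j (const w))
  exchange B c {w} j cj≢0 w≈ = generators-⊆⟨⟩ B⊆B′ ⇄ generators-⊆⟨⟩ B′⊆B
    where
    B′ = updateAt B j (const w)

    B′⊆B : ∀ i → B′ i ∈⟨ B ⟩
    B′⊆B i with i ≟ j
    ... | yes refl = ∈⟨⟩-resp (≈V-sym (cong-app (updateAt-updates i B))) (c , w≈)
    ... | no i≢j = ∈⟨⟩-resp (≈V-sym (cong-app (updateAt-minimal i j B i≢j))) (basis-∈⟨⟩ B i)

    c′ = updateAt c j (const 0#)
    rest = lincomb c′ B

    rest-∈⟨B′⟩ : rest ∈⟨ B′ ⟩
    rest-∈⟨B′⟩ = c′ , lincomb-cong agree
      where
      agree : ∀ i → (c′ i · B i) ≈V (c′ i · B′ i)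
      agree i l with i ≟ j
      ... | yes refl = subst (λ a → a * B i l ≡ a * B′ i l) (sym (updateAt-updates i c))
                             (trans (zeroˡ (B i l)) (sym (zeroˡ (B′ i l))))
      ... | no i≢j = cong (λ f → c′ i * f l) (sym (updateAt-minimal i j B i≢j))

    w-∈⟨B′⟩ : w ∈⟨ B′ ⟩
    w-∈⟨B′⟩ = ∈⟨⟩-resp (cong-app (updateAt-updates j B)) (basis-∈⟨⟩ B′ j)

    cjBj-∈⟨B′⟩ : (c j · B j) ∈⟨ B′ ⟩
    cjBj-∈⟨B′⟩ = ∈⟨⟩-resp w-rest≈cjBj (∈⟨⟩-+ w-∈⟨B′⟩ (∈⟨⟩-· (- 1#) rest-∈⟨B′⟩))
      where
      w-rest≈cjBj : (w +V ((- 1#) · rest)) ≈V (c j · B j)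
      w-rest≈cjBj l = begin
        w l + ((- 1#) * rest l)                  ≡⟨ cong₂ _+_ (trans (w≈ l) (lincomb-split c B j l)) (-1*x≈-x (rest l)) ⟩
        ((c j * B j l) + rest l) + (- rest l)    ≡⟨ //-rightDividesʳ (rest l) (c j * B j l) ⟩
        c j * B j l                              ∎
        where open ≡-Reasoning

    cj⁻¹ = proj₁ (inverse (c j) cj≢0)

    cj⁻¹·cjBj≈Bj : (cj⁻¹ · (c j · B j)) ≈V B j
    cj⁻¹·cjBj≈Bj l = begin
      cj⁻¹ * (c j * B j l)  ≡⟨ sym (*-assoc cj⁻¹ (c j) (B j l)) ⟩
      (cj⁻¹ * c j) * B j l  ≡⟨ cong (_* B j l) (trans (*-comm cj⁻¹ (c j)) (proj₂ (inverse (c j) cj≢0))) ⟩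
      1# * B j l            ≡⟨ *-identityˡ (B j l) ⟩
      B j l                 ∎
      where open ≡-Reasoning

    B⊆B′ : ∀ i → B i ∈⟨ B′ ⟩
    B⊆B′ i with i ≟ j
    ... | yes refl = ∈⟨⟩-resp cj⁻¹·cjBj≈Bj (∈⟨⟩-· cj⁻¹ cjBj-∈⟨B′⟩)
    ... | no i≢j = ∈⟨⟩-resp (cong-app (updateAt-minimal i j B i≢j)) (basis-∈⟨⟩ B′ i)

module Finiteness {q : ℕ} (𝔽 : FiniteField q) (n : ℕ) where
  open FiniteField 𝔽
  open VectorSpace 𝔽 n
  open LinearAlgebra 𝔽 n
  open Inverse enumeration using (to; from; strictlyInverseʳ)
  open Injection (↔⇒↣ enumeration) using () renaming (injective to to-injective)

  _≟ᶠ_ : DecidableEquality Carrier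
  x ≟ᶠ y = map′ to-injective (cong to) (to x ≟ to y)

  _≈V?_ : ∀ u v → Dec (u ≈V v)
  u ≈V? v = all? (λ i → u i ≟ᶠ v i)

  encodeScalars : ∀ {m} → (Fin m → Carrier) → Fin (q ^ m)
  encodeScalars c = funToFin (to ∘ c)

  decodeScalars : ∀ {m} → Fin (q ^ m) → Fin m → Carrier
  decodeScalars x = from ∘ finToFun x

  decode-encodeScalars : ∀ {m} (c : Fin m → Carrier) i → decodeScalars (encodeScalars c) i ≡ c i
  decode-encodeScalars c i = trans (cong from (finToFun-funToFin (to ∘ c) i)) (strictlyInverseʳ (c i))

  encodeScalars-injective : ∀ {m} {c c′ : Fin m → Carrier} → encodeScalars c ≡ encodeScalars c′ → ∀ i → c i ≡ c′ i
  encodeScalars-injective {c = c} {c′} eq i =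
    trans (sym (decode-encodeScalars c i)) (trans (cong (λ x → decodeScalars x i) eq) (decode-encodeScalars c′ i))

  encodeVectors : ∀ {m} → (Fin m → Vector) → Fin ((q ^ n) ^ m)
  encodeVectors B = funToFin (encodeScalars ∘ B)

  encodeVectors-injective : ∀ {m} {B B′ : Fin m → Vector} → encodeVectors B ≡ encodeVectors B′ → ∀ i → B i ≈V B′ i
  encodeVectors-injective {B = B} {B′} eq i = encodeScalars-injective (begin
    encodeScalars (B i)                                   ≡⟨ finToFun-funToFin (encodeScalars ∘ B) i ⟨
    finToFun (encodeVectors B) i                          ≡⟨ cong (λ x → finToFun x i) eq ⟩
    finToFun (encodeVectors B′) i                         ≡⟨ finToFun-funToFin (encodeScalars ∘ B′) i ⟩
    encodeScalars (B′ i)                                  ∎)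
    where open ≡-Reasoning

  any-scalars? : ∀ {m} {P : (Fin m → Carrier) → Set} →
                 (∀ {c c′} → (∀ i → c i ≡ c′ i) → P c → P c′) → (∀ c → Dec (P c)) → Dec (∃ P)
  any-scalars? {P = P} resp P? =
    map′ (λ (x , p) → decodeScalars x , p)
         (λ (c , p) → encodeScalars c , resp (λ i → sym (decode-encodeScalars c i)) p)
         (any? (P? ∘ decodeScalars))

  record Meets {k} (U W : Subspace k) : Set where
    constructor meeting
    field
      coordsᵁ coordsᵂ : Fin k → Carrier
      common          : lincomb coordsᵁ (basis U) ≈V lincomb coordsᵂ (basis W)
      nonzero         : ¬ (lincomb coordsᵁ (basis U) ≈V zeroV)

  meets? : ∀ {k} (U W : Subspace k) → Dec (Meets U W)
  meets? U W =
    map′ (λ (c , d , cU≈dW , cU≉0) → meeting c d cU≈dW cU≉0)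
         (λ (meeting c d cU≈dW cU≉0) → c , d , cU≈dW , cU≉0)
         (any-scalars? resp-c λ c → any-scalars? (resp-d c) λ d →
            (lincomb c (basis U) ≈V? lincomb d (basis W)) ×-dec ¬? (lincomb c (basis U) ≈V? zeroV))
    where
    Common : (c d : _) → Set
    Common c d = lincomb c (basis U) ≈V lincomb d (basis W) × ¬ (lincomb c (basis U) ≈V zeroV)
    resp-d : ∀ c {d d′} → (∀ i → d i ≡ d′ i) → Common c d → Common c d′
    resp-d c d≡d′ (cU≈dW , cU≉0) = ≈V-trans cU≈dW (lincomb-congˡ d≡d′) , cU≉0
    resp-c : ∀ {c c′} → (∀ i → c i ≡ c′ i) → ∃ (Common c) → ∃ (Common c′)
    resp-c c≡c′ (d , cU≈dW , cU≉0) =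
      d , ≈V-trans (lincomb-congˡ (sym ∘ c≡c′)) cU≈dW , cU≉0 ∘ ≈V-trans (lincomb-congˡ c≡c′)

  ¬Meets⇒Disjoint : ∀ {k} (U W : Subspace k) → ¬ Meets U W → Disjoint U W
  ¬Meets⇒Disjoint U W ¬meets v (c , v≈cU) (d , v≈dW) = decidable-stable (v ≈V? zeroV) λ v≉0 →
    ¬meets (meeting c d (≈V-trans (≈V-sym v≈cU) v≈dW) (v≉0 ∘ ≈V-trans v≈cU))

  Disjoint-sym : ∀ {k} (U W : Subspace k) → Disjoint U W → Disjoint W U
  Disjoint-sym U W U∩W≈0 v v∈W v∈U = U∩W≈0 v v∈U v∈W

  nonzero-coefficient : ∀ {k} (B : Fin k → Vector) (c : Fin k → Carrier) →
                        ¬ (lincomb c B ≈V zeroV) → ∃ λ j → c j ≢ 0#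
  nonzero-coefficient B c cB≉0 = ¬∀⟶∃¬ _ _ (λ j → c j ≟ᶠ 0#) λ c≡0 →
    cB≉0 (≈V-trans (lincomb-congˡ c≡0) (lincomb-zeroˡ B))

-- The number of values of Counting.exchangeCode for (k+1)-spaces: a pivot, the coordinates in P
-- of a common vector, and the k remaining basis vectors.
meetBound : ℕ → ℕ → ℕ → ℕ
meetBound q n k = suc k ℕ.* (q ^ suc k ℕ.* (q ^ n) ^ k)

module _ {A : Set} {_≈_ : A → A → Set} (≈-sym : Symmetric _≈_) where
  open import Data.List.Relation.Unary.AllPairs using (AllPairs; _∷_)

  lookup-injective : ∀ {xs} → AllPairs (λ x y → ¬ x ≈ y) xs → ∀ {i j} → lookup xs i ≈ lookup xs j → i ≡ j
  lookup-injective (_  ∷ _)   {zero}  {zero}  _  = refl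
  lookup-injective (x≉ ∷ _)   {zero}  {suc j} eq = contradiction eq (All.lookup x≉ (∈-lookup j))
  lookup-injective (x≉ ∷ _)   {suc i} {zero}  eq = contradiction (≈-sym eq) (All.lookup x≉ (∈-lookup i))
  lookup-injective (_  ∷ xs≉) {suc i} {suc j} eq = cong suc (lookup-injective xs≉ eq)

module Counting {q : ℕ} (𝔽 : FiniteField q) (n : ℕ) where
  open FiniteField 𝔽 using (Carrier)
  open import Data.Nat using (_*_)
  open VectorSpace 𝔽 n
  open LinearAlgebra 𝔽 n
  open Finiteness 𝔽 n

  updateAt-≈V : ∀ {k} {B B′ : Fin (suc k) → Vector} j {w w′} → w ≈V w′ →
                (∀ i → B (punchIn j i) ≈V B′ (punchIn j i)) →
                ∀ i → updateAt B j (const w) i ≈V updateAt B′ j (const w′) i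
  updateAt-≈V {B = B} {B′} j w≈w′ rest≈ i with i ≟ j
  ... | yes refl = subst₂ _≈V_ (sym (updateAt-updates i B)) (sym (updateAt-updates i B′)) w≈w′
  ... | no i≢j = subst₂ _≈V_ (sym (updateAt-minimal i j B i≢j)) (sym (updateAt-minimal i j B′ i≢j))
                   (subst (λ i → B i ≈V B′ i) (punchIn-punchOut j≢i) (rest≈ (punchOut j≢i)))
    where j≢i = i≢j ∘ sym

  record Exchange {k} (U P : Subspace (suc k)) : Set where
    field
      pivot  : Fin (suc k)
      coords : Fin (suc k) → Carrier
      spans  : SameSpan (basis U) (updateAt (basis U) pivot (const (lincomb coords (basis P))))

  open Exchange

  exchangeCode : ∀ {k} {U P : Subspace (suc k)} → Exchange U P → Fin (meetBound q n k)
  exchangeCode {U = U} e =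
    combine (pivot e) (combine (encodeScalars (coords e)) (encodeVectors (basis U ∘ punchIn (pivot e))))

  Meets⇒Exchange : ∀ {k} {U P : Subspace (suc k)} → Meets U P → Exchange U P
  Meets⇒Exchange {U = U} (meeting c d cU≈dP cU≉0) = record
    { pivot  = j
    ; coords = d
    ; spans  = exchange (basis U) c j cj≢0 (≈V-sym cU≈dP)
    }
    where open Σ (nonzero-coefficient (basis U) c cU≉0) renaming (proj₁ to j; proj₂ to cj≢0)

  exchangeCode-injective : ∀ {k} {U U′ P : Subspace (suc k)} (e : Exchange U P) (e′ : Exchange U′ P) →
                   exchangeCode e ≡ exchangeCode e′ → SameSpan (basis U) (basis U′)
  exchangeCode-injective {U = U} {U′} {P} e e′ eq
    with refl , eq′ ← combine-injective (pivot e) _ (pivot e′) _ eq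
    with coords≡ , rest≡ ← combine-injective (encodeScalars (coords e)) _ (encodeScalars (coords e′)) _ eq′ =
    SameSpan-trans (spans e) (SameSpan-trans (≈V-SameSpan updated≈) (SameSpan-sym (spans e′)))
    where
    updated≈ = updateAt-≈V {B = basis U} {basis U′} (pivot e)
      (lincomb-congˡ {B = basis P} (encodeScalars-injective {c = coords e} {coords e′} coords≡))
      (encodeVectors-injective rest≡)

  SameSpan⇒≐ : ∀ {k} {U W : Subspace k} → SameSpan (basis U) (basis W) → U ≐ W
  SameSpan⇒≐ (U⊆W ⇄ W⊆U) = U⊆W , W⊆U

  ≐-sym : ∀ {k} (U W : Subspace k) → U ≐ W → W ≐ U
  ≐-sym U W (U⊆W , W⊆U) = W⊆U , U⊆W

  module _ {k t} (P : Fin t → Subspace (suc k)) where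

    meetingCode : ∀ {U} → (∃ λ r → Meets U (P r)) → Fin (t * meetBound q n k)
    meetingCode (r , m) = combine r (exchangeCode (Meets⇒Exchange m))

    meetingCode-injective : ∀ {U U′} (m : ∃ λ r → Meets U (P r)) (m′ : ∃ λ r → Meets U′ (P r)) →
                      meetingCode m ≡ meetingCode m′ → U ≐ U′
    meetingCode-injective {U} {U′} (r , m) (r′ , m′) eq with refl ← combine-injectiveˡ r _ r′ _ eq =
      SameSpan⇒≐ {U = U} {U′}
        (exchangeCode-injective (Meets⇒Exchange m) (Meets⇒Exchange m′) (combine-injectiveʳ r _ r _ eq))

    module _ (𝒱 : Family (suc k)) where
      private
        member : Fin (card 𝒱) → Subspace (suc k)
        member = lookup (members 𝒱)

      all-meet⇒card≤ : (∀ a → ∃ λ r → Meets (member a) (P r)) → card 𝒱 ≤ t * meetBound q n k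
      all-meet⇒card≤ meet = injective⇒≤ {f = meetingCode ∘ meet} λ {a} {b} eq →
        lookup-injective (λ {U} {W} → ≐-sym U W) (distinct 𝒱) (meetingCode-injective (meet a) (meet b) eq)

      disjoint-member : t * meetBound q n k < card 𝒱 → ∃ λ a → ∀ r → Disjoint (member a) (P r)
      disjoint-member large with any? (λ a → ¬? (any? λ r → meets? (member a) (P r)))
      ... | yes (a , meets-none) = a , λ r → ¬Meets⇒Disjoint (member a) (P r) λ m → meets-none (r , m)
      ... | no ¬∃ = contradiction (all-meet⇒card≤ all-meet) (<⇒≱ large)
        where
        all-meet : ∀ a → ∃ λ r → Meets (member a) (P r)
        all-meet a = decidable-stable (any? λ r → meets? (member a) (P r)) λ meets-none → ¬∃ (a , meets-none)

module Transversals {q : ℕ} (𝔽 : FiniteField q) (n : ℕ) where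
  open VectorSpace 𝔽 n
  open Finiteness 𝔽 n
  open Counting 𝔽 n
  open import Data.Nat using (_*_)

  Transversal : ∀ {k t} → (Fin t → Family k) → Set
  Transversal {t = t} 𝒱 = Σ ((i : Fin t) → Fin (card (𝒱 i))) λ pick →
    (i j : Fin t) → i ≢ j → Disjoint (lookup (members (𝒱 i)) (pick i)) (lookup (members (𝒱 j)) (pick j))

  transversal : ∀ {k t} s → t ≤ suc s → (𝒱 : Fin t → Family (suc k)) →
                (∀ i → s * meetBound q n k < card (𝒱 i)) → Transversal 𝒱
  transversal {t = zero}  s _      𝒱 _     = (λ ()) , λ ()
  transversal {t = suc t} s t<1+s 𝒱 large = pick , disjoint
    where
    rest = transversal s (≤-trans (n≤1+n t) t<1+s) (𝒱 ∘ suc) (large ∘ suc)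

    P : Fin t → Subspace _
    P r = lookup (members (𝒱 (suc r))) (proj₁ rest r)

    first = disjoint-member P (𝒱 zero) (≤-<-trans (*-monoˡ-≤ _ (s≤s⁻¹ t<1+s)) (large zero))

    pick : (i : Fin (suc t)) → Fin (card (𝒱 i))
    pick zero    = proj₁ first
    pick (suc i) = proj₁ rest i

    disjoint : (i j : Fin (suc t)) → i ≢ j →
               Disjoint (lookup (members (𝒱 i)) (pick i)) (lookup (members (𝒱 j)) (pick j))
    disjoint zero    zero    0≢0 = contradiction refl 0≢0
    disjoint zero    (suc j) _   = proj₂ first j
    disjoint (suc i) zero    _   = Disjoint-sym (lookup (members (𝒱 zero)) (pick zero)) (P i) (proj₂ first i)
    disjoint (suc i) (suc j) i≢j = proj₂ rest i j (i≢j ∘ cong suc)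

module GaussianGap where
  open import Data.Nat
  open import Data.Nat.Properties
  open import Data.Nat.DivMod using (_/_; m*n/n≡m; +-distrib-/-∣ʳ; /-monoˡ-≤)
  open import Data.Nat.Divisibility using (divides)
  open import Algebra.Properties.CommutativeSemigroup *-commutativeSemigroup using (x∙yz≈y∙xz)

  prodUpTo-mono : ∀ m {f g : ℕ → ℕ} → (∀ i → i < m → f i ≤ g i) → prodUpTo m f ≤ prodUpTo m g
  prodUpTo-mono zero    f≤g = ≤-refl
  prodUpTo-mono (suc m) f≤g = *-mono-≤ (prodUpTo-mono m λ i i<m → f≤g i (m<n⇒m<1+n i<m)) (f≤g m ≤-refl)

  prodUpTo-const : ∀ m x → prodUpTo m (const x) ≡ x ^ m
  prodUpTo-const zero    x = refl
  prodUpTo-const (suc m) x = trans (cong (_* x) (prodUpTo-const m x)) (*-comm (x ^ m) x)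

  numerator : ℕ → ℕ → ℕ → ℕ
  numerator q n k = prodUpTo k (λ i → q ^ (n ∸ i) ∸ 1)

  divN-gap : ∀ {a b d x} → 1 ≤ d → b + d * x ≤ a → x ≤ divN a d ∸ divN b d
  divN-gap {a} {b} {suc d} {x} _ b+dx≤a = begin
    x                                 ≡⟨ m+n∸m≡n (b / D) x ⟨
    (b / D + x) ∸ b / D               ≡⟨ cong (λ y → (b / D + y) ∸ b / D) (m*n/n≡m x D) ⟨
    (b / D + x * D / D) ∸ b / D       ≡⟨ cong (_∸ b / D) (+-distrib-/-∣ʳ b (divides x refl)) ⟨
    (b + x * D) / D ∸ b / D           ≤⟨ ∸-monoˡ-≤ (b / D) (/-monoˡ-≤ D b+xD≤a) ⟩
    a / D ∸ b / D                     ∎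
    where
    open ≤-Reasoning
    D = suc d
    b+xD≤a = subst (_≤ a) (cong (b +_) (*-comm D x)) b+dx≤a

  meetBound-+ : ∀ q m A k → meetBound q (m + A) k ≡ meetBound q m k * (q ^ A) ^ k
  meetBound-+ q m A k = begin
    suc k * (q ^ suc k * (q ^ (m + A)) ^ k)              ≡⟨ cong (λ y → suc k * (q ^ suc k * y)) [q^[m+A]]^k≡ ⟩
    suc k * (q ^ suc k * (Qm * QA))                      ≡⟨ cong (suc k *_) (*-assoc (q ^ suc k) Qm QA) ⟨
    suc k * (q ^ suc k * Qm * QA)                        ≡⟨ *-assoc (suc k) (q ^ suc k * Qm) QA ⟨
    meetBound q m k * QA                                 ∎
    where
    open ≡-Reasoning
    Qm = (q ^ m) ^ k
    QA = (q ^ A) ^ k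

    [q^[m+A]]^k≡ : (q ^ (m + A)) ^ k ≡ Qm * QA
    [q^[m+A]]^k≡ = begin
      (q ^ (m + A)) ^ k             ≡⟨ ^-*-assoc q (m + A) k ⟩
      q ^ ((m + A) * k)             ≡⟨ cong (q ^_) (*-distribʳ-+ k m A) ⟩
      q ^ (m * k + A * k)           ≡⟨ ^-distribˡ-+-* q (m * k) (A * k) ⟩
      q ^ (m * k) * q ^ (A * k)     ≡⟨ cong₂ _*_ (^-*-assoc q m k) (^-*-assoc q A k) ⟨
      Qm * QA                       ∎

  module _ {q : ℕ} (2≤q : 2 ≤ q) where
    private instance
      q≢0 : NonZero q
      q≢0 = >-nonZero (<-≤-trans z<s 2≤q)

    m<q^m : ∀ m → m < q ^ m
    m<q^m zero    = z<s
    m<q^m (suc m) = begin-strict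
      suc m      ≤⟨ m<q^m m ⟩
      q ^ m      <⟨ m<m*n (q ^ m) q {{m^n≢0 q m}} 2≤q ⟩
      q ^ m * q  ≡⟨ *-comm (q ^ m) q ⟩
      q ^ suc m  ∎
      where open ≤-Reasoning

    q^m≤q^[1+m]∸1 : ∀ m → q ^ m ≤ q ^ suc m ∸ 1
    q^m≤q^[1+m]∸1 m = ∸-monoˡ-≤ 1 (subst (suc (q ^ m) ≤_) (*-comm (q ^ m) q) (m<m*n (q ^ m) q {{m^n≢0 q m}} 2≤q))

    q^A≤q^m∸1 : ∀ {A m} → A < m → q ^ A ≤ q ^ m ∸ 1
    q^A≤q^m∸1 {m = suc m} (s≤s A≤m) = ≤-trans (^-monoʳ-≤ q A≤m) (q^m≤q^[1+m]∸1 m)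

    2*[q^m∸1]≤q^[1+m]∸1 : ∀ m → 2 * (q ^ m ∸ 1) ≤ q ^ suc m ∸ 1
    2*[q^m∸1]≤q^[1+m]∸1 m = begin
      2 * (q ^ m ∸ 1)   ≡⟨ *-distribˡ-∸ 2 (q ^ m) 1 ⟩
      2 * q ^ m ∸ 2     ≤⟨ ∸-monoʳ-≤ (2 * q ^ m) (s≤s z≤n) ⟩
      2 * q ^ m ∸ 1     ≤⟨ ∸-monoˡ-≤ 1 (*-monoˡ-≤ (q ^ m) 2≤q) ⟩
      q ^ suc m ∸ 1     ∎
      where open ≤-Reasoning

    numerator-positive : ∀ {n k} → k ≤ n → 1 ≤ numerator q n k
    numerator-positive {n} {k} k≤n = begin
      1                       ≡⟨ ^-zeroˡ k ⟨
      1 ^ k                   ≡⟨ prodUpTo-const k 1 ⟨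
      prodUpTo k (const 1)    ≤⟨ prodUpTo-mono k (λ i i<k → q^A≤q^m∸1 (m<n⇒0<n∸m (<-≤-trans i<k k≤n))) ⟩
      numerator q n k         ∎
      where open ≤-Reasoning

    numerator-upper : ∀ n k → numerator q n k ≤ (q ^ n) ^ k
    numerator-upper n k = begin
      numerator q n k           ≤⟨ prodUpTo-mono k (λ i _ → ≤-trans (m∸n≤m _ 1) (^-monoʳ-≤ q (m∸n≤m n i))) ⟩
      prodUpTo k (const (q ^ n)) ≡⟨ prodUpTo-const k (q ^ n) ⟩
      (q ^ n) ^ k               ∎
      where open ≤-Reasoning

    numerator-lower : ∀ k A → (q ^ A) ^ k ≤ numerator q (k + A) k
    numerator-lower k A = begin
      (q ^ A) ^ k                 ≡⟨ prodUpTo-const k (q ^ A) ⟨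
      prodUpTo k (const (q ^ A))  ≤⟨ prodUpTo-mono k (λ i i<k → q^A≤q^m∸1 (A<k+A∸i i<k)) ⟩
      numerator q (k + A) k       ∎
      where
      open ≤-Reasoning
      A<k+A∸i : ∀ {i} → i < k → A < k + A ∸ i
      A<k+A∸i {i} i<k = subst (A <_) (sym (+-∸-comm A (<⇒≤ i<k))) (m<n+m A (m<n⇒0<n∸m i<k))

    numerator-double : ∀ {n k} → k ≤ n → 2 * numerator q n (suc k) ≤ numerator q (suc n) (suc k)
    numerator-double {n} {k} k≤n = begin
      2 * (numerator q n k * f k)   ≡⟨ x∙yz≈y∙xz 2 (numerator q n k) (f k) ⟩
      numerator q n k * (2 * f k)   ≤⟨ *-mono-≤ (prodUpTo-mono k λ i i<k → f≤2*f≤g i (m<n⇒m<1+n i<k)) (2*f≤g k ≤-refl) ⟩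
      numerator q (suc n) k * g k   ∎
      where
      open ≤-Reasoning
      f g : ℕ → ℕ
      f i = q ^ (n ∸ i) ∸ 1
      g i = q ^ (suc n ∸ i) ∸ 1
      2*f≤g : ∀ i → i < suc k → 2 * f i ≤ g i
      2*f≤g i i<1+k = subst (λ m → 2 * f i ≤ q ^ m ∸ 1) (sym (+-∸-assoc 1 (≤-trans (s≤s⁻¹ i<1+k) k≤n)))
                            (2*[q^m∸1]≤q^[1+m]∸1 (n ∸ i))
      f≤2*f≤g : ∀ i → i < suc k → f i ≤ g i
      f≤2*f≤g i i<1+k = ≤-trans (m≤m+n (f i) (f i + 0)) (2*f≤g i i<1+k)

    module _ (k s : ℕ) where
      private
        C = s * meetBound q (suc (suc k)) k
        M = (q ^ suc k) ^ suc k * suc C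

      -- The numerator at least doubles from b to a, so it suffices that D (X + 1) ≤ b; and indeed
      -- X grows only like q^(Ak) while b grows like q^(A(k+1)).
      gauss-gap-exceeds-at : ∀ A → M ≤ A →
        s * meetBound q (suc (suc k) + A) k < gauss q (suc (suc k) + A) (suc k) ∸ gauss q (suc k + A) (suc k)
      gauss-gap-exceeds-at A M≤A = divN-gap {a} {b} {D} (numerator-positive {suc k} ≤-refl) (begin
        b + D * suc X    ≤⟨ +-monoʳ-≤ b D*[1+X]≤b ⟩
        b + b            ≡⟨ cong (b +_) (+-identityʳ b) ⟨
        2 * b            ≤⟨ numerator-double (≤-trans (m≤m+n k A) (n≤1+n (k + A))) ⟩
        a                ∎)
        where
        open ≤-Reasoning
        a = numerator q (suc (suc k) + A) (suc k)
        b = numerator q (suc k + A) (suc k)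
        D = numerator q (suc k) (suc k)
        X = s * meetBound q (suc (suc k) + A) k
        Y = (q ^ A) ^ k

        X≡C*Y : X ≡ C * Y
        X≡C*Y = trans (cong (s *_) (meetBound-+ q (suc (suc k)) A k)) (sym (*-assoc s _ Y))

        1+X≤[1+C]*Y : suc X ≤ suc C * Y
        1+X≤[1+C]*Y = begin
          suc X         ≡⟨ cong suc X≡C*Y ⟩
          1 + C * Y     ≤⟨ +-monoˡ-≤ (C * Y) (m^n>0 (q ^ A) {{m^n≢0 q A}} k) ⟩
          Y + C * Y     ∎

        D*[1+X]≤b : D * suc X ≤ b
        D*[1+X]≤b = begin
          D * suc X                              ≤⟨ *-mono-≤ (numerator-upper (suc k) (suc k)) 1+X≤[1+C]*Y ⟩
          (q ^ suc k) ^ suc k * (suc C * Y)      ≡⟨ *-assoc ((q ^ suc k) ^ suc k) (suc C) Y ⟨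
          M * Y                                  ≤⟨ *-monoˡ-≤ Y (<⇒≤ (≤-<-trans M≤A (m<q^m A))) ⟩
          (q ^ A) ^ suc k                        ≤⟨ numerator-lower (suc k) A ⟩
          b                                      ∎

      gauss-gap-exceeds : ∃ λ n₀ → ∀ n → n₀ ≤ n →
        s * meetBound q n k < gauss q n (suc k) ∸ gauss q (n ∸ 1) (suc k)
      gauss-gap-exceeds = suc (suc k) + M , λ n n₀≤n →
        subst (λ n → s * meetBound q n k < gauss q n (suc k) ∸ gauss q (n ∸ 1) (suc k))
              (m+[n∸m]≡n (≤-trans (m≤m+n (suc (suc k)) M) n₀≤n))
              (gauss-gap-exceeds-at (n ∸ suc (suc k)) (M≤n∸[2+k] n₀≤n))
        where
        M≤n∸[2+k] : ∀ {n} → suc (suc k) + M ≤ n → M ≤ n ∸ suc (suc k)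
        M≤n∸[2+k] {n} n₀≤n = m+n≤o⇒m≤o∸n M (subst (_≤ n) (+-comm (suc (suc k)) M) n₀≤n)

FiniteField⇒2≤q : ∀ {q} → FiniteField q → 2 ≤ q
FiniteField⇒2≤q 𝔽 = injective⇒≤ {f = to ∘ (0# ∷ 1# ∷ [])} injective
  where
  open FiniteField 𝔽 using (0#; 1#; 0≢1; enumeration)
  open Inverse enumeration using (to)
  open Injection (↔⇒↣ enumeration) using () renaming (injective to to-injective)
  open import Data.Vec.Functional using (_∷_; [])

  injective : Injective _≡_ _≡_ (to ∘ (0# ∷ 1# ∷ []))
  injective {zero}     {zero}     _  = refl
  injective {zero}     {suc zero} eq = contradiction (to-injective eq) 0≢1
  injective {suc zero} {zero}     eq = contradiction (sym (to-injective eq)) 0≢1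
  injective {suc zero} {suc zero} _  = refl

minFin-≤ : ∀ {m} (f : Fin (suc m) → ℕ) i → minFin f ≤ f i
minFin-≤ {zero}  f zero    = ≤-refl
minFin-≤ {suc m} f zero    = m⊓n≤m _ _
minFin-≤ {suc m} f (suc i) = ≤-trans (m⊓n≤n _ _) (minFin-≤ (f ∘ suc) i)

open Transversals using (transversal)
open GaussianGap using (gauss-gap-exceeds)

theorem4p11 : (q k s : ℕ) → 1 ≤ k → 1 ≤ s → (𝔽 : FiniteField q) →
    ∃ λ n₀ → (n : ℕ) → n₀ ≤ n →
      let open VectorSpace 𝔽 n in
      (𝒱 : Fin (suc s) → Family k) →
      ¬ (Σ ((i : Fin (suc s)) → Fin (card (𝒱 i))) λ pick →
           (i j : Fin (suc s)) → i ≢ j →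
             Disjoint (lookup (members (𝒱 i)) (pick i)) (lookup (members (𝒱 j)) (pick j))) →
      minFin (λ i → card (𝒱 i)) ≤ gauss q n k ∸ gauss q (n ∸ 1) k
theorem4p11 q zero    s () _ 𝔽
theorem4p11 q (suc k) s _  _ 𝔽 = n₀ , λ n n₀≤n 𝒱 no-transversal →
  decidable-stable (_ ≤? _) λ min≰gap →
    no-transversal (transversal 𝔽 n s ≤-refl 𝒱 λ i →
      <-≤-trans (<-trans (s*bound<gap n n₀≤n) (≰⇒> min≰gap)) (minFin-≤ _ i))
  where open Σ (gauss-gap-exceeds (FiniteField⇒2≤q 𝔽) k s) renaming (proj₁ to n₀; proj₂ to s*bound<gap)
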